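{- For all types $\sigma,\rho$ and terms $r,s,t$: if $r\in[\![\rho]\!]$, $s\in[\![\sigma\to\mathtt{list}\,\sigma\to\rho\to\rho]\!]$ and $t\in[\![\mathtt{list}\,\sigma]\!]$, then $\mathtt{lrec}\,r\,s\,t\in[\![\rho]\!]$.
   Context: Calculus $\lambda^{::}_{\mathtt{catch}}$. Types: $\sigma,\tau,\rho ::= \mathtt{unit} \mid \mathtt{list}\,\tau \mid \sigma\to\tau$ ($\to$ associates to the right). Terms: $t,r,s ::= x \mid () \mid \mathtt{nil} \mid (::) \mid \mathtt{lrec} \mid \lambda x.r \mid t\,s \mid \mathtt{catch}\,\alpha\,t \mid \mathtt{throw}\,\alpha\,t$ ($x$ variables, $\alpha,\beta$ continuation variables; application left-associative; $t::r$ abbreviates $(::)\,t\,r$). $\mathrm{FCV}$ = free continuation variables, $t[x:=r]$ capture-avoiding substitution. Values: $v,w ::= x \mid () \mid \mathtt{nil} \mid (::) \mid (::)\,v \mid (::)\,v\,w \mid \mathtt{lrec} \mid \mathtt{lrec}\,v \mid \mathtt{lrec}\,v\,w \mid \lambda x.r$. Contexts $E ::= \Box\,t \mid v\,\Box \mid \mathtt{throw}\,\alpha\,\Box$. Reduction $\to$ is the compatible closure of: $(\lambda x.t)\,v\to t[x:=v]$; $E[\mathtt{throw}\,\alpha\,t]\to\mathtt{throw}\,\alpha\,t$; $\mathtt{catch}\,\alpha\,(\mathtt{throw}\,\alpha\,t)\to\mathtt{catch}\,\alpha\,t$; $\mathtt{catch}\,\alpha\,(\mathtt{throw}\,\beta\,v)\to\mathtt{throw}\,\beta\,v$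 if $\alpha\notin\{\beta\}\cup\mathrm{FCV}(v)$; $\mathtt{catch}\,\alpha\,v\to v$ if $\alpha\notin\mathrm{FCV}(v)$; $\mathtt{lrec}\,v_r\,v_s\,\mathtt{nil}\to v_r$; $\mathtt{lrec}\,v_r\,v_s\,(v_h::v_t)\to v_s\,v_h\,v_t\,(\mathtt{lrec}\,v_r\,v_s\,v_t)$; $\twoheadrightarrow$ is its reflexive-transitive closure. $\mathrm{SN}$ is the set of terms $t$ for which the lengths of all reduction sequences starting at $t$ are bounded. For a set of terms $S$, $L(S)$ is inductively defined by: $t\in L(S)$ if for all values $v,w$ with $t\twoheadrightarrow v::w$ we have $v\in S$ and $w\in L(S)$. Interpretation: $[\![\mathtt{unit}]\!]=\mathrm{SN}$, $[\![\mathtt{list}\,\sigma]\!]=\mathrm{SN}\cap L([\![\sigma]\!])$, $[\![\sigma\to\tau]\!]=\{t\mid \forall s\in[\![\sigma]\!],\ ts\in[\![\tau]\!]\}$. -}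

module Defs where

open import Data.Nat using (ℕ; zero; suc; _≤_)
open import Data.Product using (Σ; _×_)
open import Relation.Binary.Construct.Closure.ReflexiveTransitive using (Star)

infixr 30 _⇒_

data Ty : Set where
  unit : Ty
  list : Ty → Ty
  _⇒_  : Ty → Ty → Ty

-- Terms (untyped, de Bruijn indices for both term variables and
-- continuation variables).  `lam t` binds term variable 0 in t;
-- `catch t` binds continuation variable 0 in t.

infixl 40 _·_

data Tm : Set where
  var   : ℕ → Tm
  ⋆     : Tm
  nil   : Tm
  cons  : Tm
  lrec  : Tm
  lam   : Tm → Tm
  _·_   : Tm → Tm → Tm
  catch : Tm → Tm
  throw : ℕ → Tm → Tm

infixr 35 _∷ₜ_
_∷ₜ_ : Tm → Tm → Tm
t ∷ₜ r = cons · t · r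

ext : (ℕ → ℕ) → ℕ → ℕ
ext ρ zero    = zero
ext ρ (suc n) = suc (ρ n)

ren : (ℕ → ℕ) → Tm → Tm
ren ρ (var x)     = var (ρ x)
ren ρ ⋆           = ⋆
ren ρ nil         = nil
ren ρ cons        = cons
ren ρ lrec        = lrec
ren ρ (lam t)     = lam (ren (ext ρ) t)
ren ρ (t · s)     = ren ρ t · ren ρ s
ren ρ (catch t)   = catch (ren ρ t)
ren ρ (throw α t) = throw α (ren ρ t)

renC : (ℕ → ℕ) → Tm → Tm
renC ρ (var x)     = var x
renC ρ ⋆           = ⋆
renC ρ nil         = nil
renC ρ cons        = cons
renC ρ lrec        = lrec
renC ρ (lam t)     = lam (renC ρ t)
renC ρ (t · s)     = renC ρ t · renC ρ s
renC ρ (catch t)   = catch (renC (ext ρ) t)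
renC ρ (throw α t) = throw (ρ α) (renC ρ t)

-- shifting continuation variables by one (used to express α ∉ FCV)
⇑c : Tm → Tm
⇑c = renC suc

exts : (ℕ → Tm) → ℕ → Tm
exts σ zero    = var zero
exts σ (suc n) = ren suc (σ n)

sub : (ℕ → Tm) → Tm → Tm
sub σ (var x)     = σ x
sub σ ⋆           = ⋆
sub σ nil         = nil
sub σ cons        = cons
sub σ lrec        = lrec
sub σ (lam t)     = lam (sub (exts σ) t)
sub σ (t · s)     = sub σ t · sub σ s
sub σ (catch t)   = catch (sub (λ n → ⇑c (σ n)) t)
sub σ (throw α t) = throw α (sub σ t)

single : Tm → ℕ → Tm
single v zero    = v
single v (suc n) = var n

_[_] : Tm → Tm → Tm
t [ v ] = sub (single v) t

data Value : Tm → Set where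
  v-var   : ∀ {x} → Value (var x)
  v-unit  : Value ⋆
  v-nil   : Value nil
  v-cons0 : Value cons
  v-cons1 : ∀ {v} → Value v → Value (cons · v)
  v-cons2 : ∀ {v w} → Value v → Value w → Value (cons · v · w)
  v-lrec0 : Value lrec
  v-lrec1 : ∀ {v} → Value v → Value (lrec · v)
  v-lrec2 : ∀ {v w} → Value v → Value w → Value (lrec · v · w)
  v-lam   : ∀ {r} → Value (lam r)

-- In de Bruijn form, `catch α` binds index 0; the side condition
-- α ∉ FCV(v) is expressed by v being of the form ⇑c v' (and then the
-- result is v', i.e. v with the binder removed).

infix 4 _⟶_

data _⟶_ : Tm → Tm → Set where
  β       : ∀ {t v} → Value v → lam t · v ⟶ t [ v ]
  -- E[throw α t] → throw α t, for E ::= □ t | v □ | throw α □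
  thr-appL : ∀ {α t s} → throw α t · s ⟶ throw α t
  thr-appR : ∀ {v α t} → Value v → v · throw α t ⟶ throw α t
  thr-thr  : ∀ {β α t} → throw β (throw α t) ⟶ throw α t
  catch-thr-same : ∀ {t} → catch (throw zero t) ⟶ catch t
  -- catch α (throw β v) → throw β v   if α ∉ {β} ∪ FCV(v)
  catch-thr-other : ∀ {β v} → Value v →
                    catch (throw (suc β) (⇑c v)) ⟶ throw β v
  catch-val : ∀ {v} → Value v → catch (⇑c v) ⟶ v
  lrec-nil  : ∀ {vr vs} → Value vr → Value vs → lrec · vr · vs · nil ⟶ vr
  lrec-cons : ∀ {vr vs vh vt} → Value vr → Value vs → Value vh → Value vt →
              lrec · vr · vs · (vh ∷ₜ vt) ⟶ vs · vh · vt · (lrec · vr · vs · vt)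
  ξ-lam   : ∀ {t t'} → t ⟶ t' → lam t ⟶ lam t'
  ξ-appL  : ∀ {t t' s} → t ⟶ t' → t · s ⟶ t' · s
  ξ-appR  : ∀ {t s s'} → s ⟶ s' → t · s ⟶ t · s'
  ξ-catch : ∀ {t t'} → t ⟶ t' → catch t ⟶ catch t'
  ξ-throw : ∀ {α t t'} → t ⟶ t' → throw α t ⟶ throw α t'

infix 4 _↠_
_↠_ : Tm → Tm → Set
_↠_ = Star _⟶_

data Steps : ℕ → Tm → Tm → Set where
  done : ∀ {t} → Steps zero t t
  next : ∀ {n t u w} → t ⟶ u → Steps n u w → Steps (suc n) t w

SN : Tm → Set
SN t = Σ ℕ λ b → ∀ {n u} → Steps n t u → n ≤ b

data L (S : Tm → Set) (t : Tm) : Set where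
  L-intro : (∀ v w → Value v → Value w → t ↠ (v ∷ₜ w) → S v × L S w) → L S t

⟦_⟧ : Ty → Tm → Set
⟦ unit ⟧   t = SN t
⟦ list σ ⟧ t = SN t × L ⟦ σ ⟧ t
⟦ σ ⇒ τ ⟧  t = ∀ s → ⟦ σ ⟧ s → ⟦ τ ⟧ (t · s)

-- Girard's reducibility method. Every ⟦ τ ⟧ consists of strongly normalising terms, is
-- closed under reduction, contains every strongly normalising throw, and contains every
-- neutral term (neither a value nor a throw) whose reducts all lie in it. Since
-- lrec · r · s · t is neutral, it suffices that its reducts lie in ⟦ ρ ⟧, which follows by
-- induction on the derivation of L ⟦ σ ⟧ t and on the reduction trees of t, r and s: the
-- reduct s · v · w · (lrec · r · s · w) for t ↠ v ∷ₜ w is covered by the hypothesis on s.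
-- SN is defined by bounded reduction lengths; it agrees with accessibility because reduction
-- is finitely branching, which needs deciding values and the side conditions α ∉ FCV(v).
module Submission where

open import Defs
open import Data.Nat using (ℕ; zero; suc; _≤_; _⊔_; z≤n; s≤s)
open import Data.Nat.Properties using (≤-trans; ≤-pred; n≤1+n; m≤m⊔n; m≤n⊔m)
open import Induction.WellFounded using (Acc; acc)
open import Data.Product using (∃; _×_; _,_; proj₁; proj₂)
import Data.Product as Product
open import Data.List using (List; []; _∷_; [_]; map; _++_)
open import Data.List.Relation.Unary.All as All using (All; []; _∷_; lookupAny)
open import Data.List.Relation.Unary.Any as Any using (Any; here)
open import Data.List.Relation.Unary.Any.Properties using (map⁺; ++⁺ˡ; ++⁺ʳ)
import Data.Maybe as Maybe
open import Data.Maybe using (Maybe; just; nothing)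
open import Data.Maybe.Properties using (just-injective)
open import Function using (_∘_; case_of_)
open import Relation.Nullary using (Dec; yes; no; ¬_; contradiction)
open import Relation.Nullary.Decidable using (map′; _×-dec_)
open import Relation.Binary.PropositionalEquality hiding ([_])
open import Relation.Binary.Construct.Closure.ReflexiveTransitive using (ε; _◅_; _◅◅_)

value? : (t : Tm) → Dec (Value t)
value? (var x) = yes v-var
value? ⋆ = yes v-unit
value? nil = yes v-nil
value? cons = yes v-cons0
value? lrec = yes v-lrec0
value? (lam t) = yes v-lam
value? (catch t) = no λ ()
value? (throw α t) = no λ ()
value? (cons · v) = map′ v-cons1 (λ { (v-cons1 p) → p }) (value? v)
value? (lrec · v) = map′ v-lrec1 (λ { (v-lrec1 p) → p }) (value? v)
value? (cons · v · w) =
  map′ (Product.uncurry v-cons2) (λ { (v-cons2 p q) → p , q }) (value? v ×-dec value? w)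
value? (lrec · v · w) =
  map′ (Product.uncurry v-lrec2) (λ { (v-lrec2 p q) → p , q }) (value? v ×-dec value? w)
value? (var x · s) = no λ ()
value? (⋆ · s) = no λ ()
value? (nil · s) = no λ ()
value? (lam t · s) = no λ ()
value? (catch t · s) = no λ ()
value? (throw α t · s) = no λ ()
value? (var x · v · w) = no λ ()
value? (⋆ · v · w) = no λ ()
value? (nil · v · w) = no λ ()
value? (lam t · v · w) = no λ ()
value? (catch t · v · w) = no λ ()
value? (throw α t · v · w) = no λ ()
value? (t · u · v · w) = no λ ()

-- Partial inverses of continuation renamings, to decide whether a term has the form ⇑c v.

extᵐ : (ℕ → Maybe ℕ) → ℕ → Maybe ℕ
extᵐ π zero    = just zero
extᵐ π (suc n) = Maybe.map suc (π n)

renCᵐ : (ℕ → Maybe ℕ) → Tm → Maybe Tm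
renCᵐ π (var x)     = just (var x)
renCᵐ π ⋆           = just ⋆
renCᵐ π nil         = just nil
renCᵐ π cons        = just cons
renCᵐ π lrec        = just lrec
renCᵐ π (lam t)     = Maybe.map lam (renCᵐ π t)
renCᵐ π (t · s)     = Maybe.zipWith _·_ (renCᵐ π t) (renCᵐ π s)
renCᵐ π (catch t)   = Maybe.map catch (renCᵐ (extᵐ π) t)
renCᵐ π (throw α t) = Maybe.zipWith throw (π α) (renCᵐ π t)

LeftInverse : (ℕ → Maybe ℕ) → (ℕ → ℕ) → Set
LeftInverse π ρ = ∀ x → π (ρ x) ≡ just x

extᵐ-leftInverse : ∀ {π ρ} → LeftInverse π ρ → LeftInverse (extᵐ π) (ext ρ)
extᵐ-leftInverse inv zero    = refl
extᵐ-leftInverse inv (suc x) = cong (Maybe.map suc) (inv x)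

renCᵐ-leftInverse : ∀ {π ρ} → LeftInverse π ρ → ∀ t → renCᵐ π (renC ρ t) ≡ just t
renCᵐ-leftInverse inv (var x)     = refl
renCᵐ-leftInverse inv ⋆           = refl
renCᵐ-leftInverse inv nil         = refl
renCᵐ-leftInverse inv cons        = refl
renCᵐ-leftInverse inv lrec        = refl
renCᵐ-leftInverse inv (lam t)     = cong (Maybe.map lam) (renCᵐ-leftInverse inv t)
renCᵐ-leftInverse inv (t · s)     =
  cong₂ (Maybe.zipWith _·_) (renCᵐ-leftInverse inv t) (renCᵐ-leftInverse inv s)
renCᵐ-leftInverse inv (catch t)   = cong (Maybe.map catch) (renCᵐ-leftInverse (extᵐ-leftInverse inv) t)
renCᵐ-leftInverse inv (throw α t) = cong₂ (Maybe.zipWith throw) (inv α) (renCᵐ-leftInverse inv t)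

RightInverse : (ℕ → Maybe ℕ) → (ℕ → ℕ) → Set
RightInverse π ρ = ∀ {x y} → π x ≡ just y → ρ y ≡ x

extᵐ-rightInverse : ∀ {π ρ} → RightInverse π ρ → RightInverse (extᵐ π) (ext ρ)
extᵐ-rightInverse inv {zero}      refl = refl
extᵐ-rightInverse {π} inv {suc x} eq with π x in e | eq
... | just _ | refl = cong suc (inv e)

renCᵐ-rightInverse : ∀ {π ρ} → RightInverse π ρ → ∀ {t t'} → renCᵐ π t ≡ just t' → renC ρ t' ≡ t
renCᵐ-rightInverse inv {var x} refl = refl
renCᵐ-rightInverse inv {⋆}     refl = refl
renCᵐ-rightInverse inv {nil}   refl = refl
renCᵐ-rightInverse inv {cons}  refl = refl
renCᵐ-rightInverse inv {lrec}  refl = refl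
renCᵐ-rightInverse {π} inv {lam t} eq with renCᵐ π t in e | eq
... | just _ | refl = cong lam (renCᵐ-rightInverse inv e)
renCᵐ-rightInverse {π} inv {t · s} eq with renCᵐ π t in e₁ | renCᵐ π s in e₂ | eq
... | just _ | just _ | refl = cong₂ _·_ (renCᵐ-rightInverse inv e₁) (renCᵐ-rightInverse inv e₂)
renCᵐ-rightInverse {π} inv {catch t} eq with renCᵐ (extᵐ π) t in e | eq
... | just _ | refl = cong catch (renCᵐ-rightInverse (extᵐ-rightInverse inv) e)
renCᵐ-rightInverse {π} inv {throw α t} eq with π α in e₁ | renCᵐ π t in e₂ | eq
... | just _ | just _ | refl = cong₂ throw (inv e₁) (renCᵐ-rightInverse inv e₂)

unshift : Tm → Maybe Tm
unshift = renCᵐ λ { zero → nothing ; (suc α) → just α }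

unshift-⇑c : ∀ {t v} → ⇑c v ≡ t → unshift t ≡ just v
unshift-⇑c refl = renCᵐ-leftInverse (λ _ → refl) _

⇑c-unshift : ∀ {t v} → unshift t ≡ just v → ⇑c v ≡ t
⇑c-unshift = renCᵐ-rightInverse λ { {suc α} refl → refl }

⇑c-injective : ∀ {v w} → ⇑c v ≡ ⇑c w → v ≡ w
⇑c-injective eq = just-injective (trans (sym (unshift-⇑c eq)) (unshift-⇑c refl))

shiftedValue? : (t : Tm) → Dec (∃ λ v → Value v × ⇑c v ≡ t)
shiftedValue? t with unshift t in eq
... | nothing = no λ (_ , _ , e) → case trans (sym eq) (unshift-⇑c e) of λ ()
... | just v with value? v
...   | yes vv = yes (v , vv , ⇑c-unshift eq)
...   | no ¬vv = no λ (_ , vw , e) → ¬vv (subst Value (just-injective (trans (sym (unshift-⇑c e)) eq)) vw)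

Reducts : Tm → Set
Reducts t = List (∃ (t ⟶_))

_∈ᵗ_ : ∀ {t} → Tm → Reducts t → Set
u ∈ᵗ us = Any ((_≡ u) ∘ proj₁) us

ifYes : ∀ {P A : Set} → Dec P → (P → A) → List A
ifYes (yes p) f = [ f p ]
ifYes (no _)  f = []

∈ᵗ-ifYes : ∀ {P : Set} {t u} (d : Dec P) (f : P → ∃ (t ⟶_)) →
          P → (∀ p → proj₁ (f p) ≡ u) → u ∈ᵗ ifYes d f
∈ᵗ-ifYes (yes p) f _ target = here (target p)
∈ᵗ-ifYes (no ¬p) f p _      = contradiction p ¬p

thrownFunction : ∀ {t s} → Reducts (t · s)
thrownFunction {throw α u} = [ _ , thr-appL ]
thrownFunction             = []

thrownArgument : ∀ {t s} → Value t → Reducts (t · s)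
thrownArgument {s = throw α u} vt = [ _ , thr-appR vt ]
thrownArgument                 _  = []

-- The decisions are matched before the terms, so that every clause fires as soon as
-- value? has computed; reducts-complete then needs no case split on terms.
rootApp : ∀ {t s} → Dec (Value s) → Dec (Value t) → Reducts (t · s)
rootApp (yes vs)            (yes v-lam)         = [ _ , β vs ]
rootApp (yes v-nil)         (yes (v-lrec2 a b)) = [ _ , lrec-nil a b ]
rootApp (yes (v-cons2 c d)) (yes (v-lrec2 a b)) = [ _ , lrec-cons a b c d ]
rootApp (no _)              (yes vt)            = thrownArgument vt
rootApp _                   (no _)              = thrownFunction
rootApp _                   _                   = []

rootCatch : ∀ t → Reducts (catch t)
rootCatch (throw zero u)    = [ _ , catch-thr-same ]
rootCatch (throw (suc α) u) = ifYes (shiftedValue? u) λ (v , vv , e) →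
  throw α v , subst (λ u → catch (throw (suc α) u) ⟶ throw α v) e (catch-thr-other vv)
rootCatch _ = []

rootCatchValue : ∀ t → Reducts (catch t)
rootCatchValue t = ifYes (shiftedValue? t) λ (v , vv , e) →
  v , subst (λ t → catch t ⟶ v) e (catch-val vv)

rootThrow : ∀ α t → Reducts (throw α t)
rootThrow α (throw α' u) = [ _ , thr-thr ]
rootThrow α _           = []

inside : ∀ {t} (C : Tm → Tm) → (∀ {u} → t ⟶ u → C t ⟶ C u) → Reducts t → Reducts (C t)
inside C ξ = map (Product.map C ξ)

∈ᵗ-inside : ∀ {t u} {us : Reducts t} (C : Tm → Tm) {ξ : ∀ {u} → t ⟶ u → C t ⟶ C u} →
            u ∈ᵗ us → C u ∈ᵗ inside C ξ us
∈ᵗ-inside C = map⁺ ∘ Any.map (cong C)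

inside₂ : ∀ {t s} → Reducts t → Reducts s → Reducts (t · s)
inside₂ {t} {s} ts ss = inside (_· s) ξ-appL ts ++ inside (t ·_) ξ-appR ss

reducts : (t : Tm) → Reducts t
reducts (lam t)     = inside lam ξ-lam (reducts t)
reducts (t · s)     = inside₂ (reducts t) (reducts s) ++ rootApp (value? s) (value? t)
reducts (catch t)   = inside catch ξ-catch (reducts t) ++ rootCatch t ++ rootCatchValue t
reducts (throw α t) = inside (throw α) ξ-throw (reducts t) ++ rootThrow α t
reducts _           = []

rootApp⊆reducts : ∀ {t s u} {us : Reducts (t · s)} → u ∈ᵗ us → u ∈ᵗ (inside₂ (reducts t) (reducts s) ++ us)
rootApp⊆reducts {t} {s} = ++⁺ʳ (inside₂ (reducts t) (reducts s))

rootCatch⊆reducts : ∀ {t u} {us : Reducts (catch t)} → u ∈ᵗ us →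
  u ∈ᵗ (inside catch ξ-catch (reducts t) ++ us ++ rootCatchValue t)
rootCatch⊆reducts {t} = ++⁺ʳ (inside catch ξ-catch (reducts t)) ∘ ++⁺ˡ

rootCatchValue⊆reducts : ∀ {t u} {us : Reducts (catch t)} → u ∈ᵗ us →
  u ∈ᵗ (inside catch ξ-catch (reducts t) ++ rootCatch t ++ us)
rootCatchValue⊆reducts {t} = ++⁺ʳ (inside catch ξ-catch (reducts t)) ∘ ++⁺ʳ (rootCatch t)

reducts-complete : ∀ {t u} → t ⟶ u → u ∈ᵗ reducts t
reducts-complete (ξ-lam p)   = ∈ᵗ-inside lam (reducts-complete p)
reducts-complete (ξ-appL p)  = ++⁺ˡ (++⁺ˡ (∈ᵗ-inside (_· _) (reducts-complete p)))
reducts-complete {t · _} (ξ-appR p) =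
  ++⁺ˡ (++⁺ʳ (inside _ ξ-appL (reducts t)) (∈ᵗ-inside (t ·_) (reducts-complete p)))
reducts-complete (ξ-catch p) = ++⁺ˡ (∈ᵗ-inside catch (reducts-complete p))
reducts-complete (ξ-throw p) = ++⁺ˡ (∈ᵗ-inside (throw _) (reducts-complete p))
reducts-complete {lam t · s} (β v) with value? s
... | yes _  = rootApp⊆reducts (here refl)
... | no ¬v = contradiction v ¬v
reducts-complete {_ · s} thr-appL with value? s
... | yes _ = rootApp⊆reducts (here refl)
... | no _  = rootApp⊆reducts (here refl)
reducts-complete {t · _} (thr-appR v) with value? t
... | yes _  = rootApp⊆reducts (here refl)
... | no ¬v = contradiction v ¬v
reducts-complete {t · _} (lrec-nil a b) with value? t
... | yes (v-lrec2 _ _) = rootApp⊆reducts (here refl)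
... | no ¬v = contradiction (v-lrec2 a b) ¬v
reducts-complete {t · s} (lrec-cons a b c d) with value? t | value? s
... | yes (v-lrec2 _ _) | yes (v-cons2 _ _) = rootApp⊆reducts (here refl)
... | no ¬v | _ = contradiction (v-lrec2 a b) ¬v
... | _ | no ¬v = contradiction (v-cons2 c d) ¬v
reducts-complete {throw _ t} thr-thr = ++⁺ʳ (inside _ ξ-throw (reducts t)) (here refl)
reducts-complete catch-thr-same = rootCatch⊆reducts (here refl)
reducts-complete (catch-thr-other vv) =
  rootCatch⊆reducts
    (∈ᵗ-ifYes (shiftedValue? _) _ (_ , vv , refl) λ (_ , _ , e) → cong (throw _) (⇑c-injective e))
reducts-complete (catch-val vv) =
  rootCatchValue⊆reducts
    (∈ᵗ-ifYes (shiftedValue? _) _ (_ , vv , refl) λ (_ , _ , e) → ⇑c-injective e)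

upperBound : ∀ {A : Set} (f : A → ℕ) (xs : List A) → ∃ λ m → All (λ x → f x ≤ m) xs
upperBound f []       = 0 , []
upperBound f (x ∷ xs) =
  let m , fxs≤m = upperBound f xs
  in f x ⊔ m , m≤m⊔n (f x) m ∷ All.map (λ fy≤m → ≤-trans fy≤m (m≤n⊔m (f x) m)) fxs≤m

SN-intro : ∀ {t} → (∀ {u} → t ⟶ u → SN u) → SN t
SN-intro {t} sn = suc (proj₁ bound) , λ where
    done        → z≤n
    (next p st) → s≤s (reduct-bounded (reducts-complete p) st)
  where
  bound : ∃ λ m → All (λ (_ , p) → proj₁ (sn p) ≤ m) (reducts t)
  bound = upperBound (λ (_ , p) → proj₁ (sn p)) (reducts t)

  reduct-bounded : ∀ {n u w} → u ∈ᵗ reducts t → Steps n u w → n ≤ proj₁ bound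
  reduct-bounded {n} {w = w} i st =
    let b≤m , eq = lookupAny (proj₂ bound) i
    in ≤-trans (proj₂ (sn _) (subst (λ x → Steps n x w) (sym eq) st)) b≤m

SN-step : ∀ {t t'} → SN t → t ⟶ t' → SN t'
SN-step (b , bound) p = b , λ st → ≤-trans (n≤1+n _) (bound (next p st))

_⟵_ : Tm → Tm → Set
u ⟵ t = t ⟶ u

SN⇒Acc : ∀ {t} → SN t → Acc _⟵_ t
SN⇒Acc (b , bound) = go b bound
  where
  go : ∀ b {t} → (∀ {n u} → Steps n t u → n ≤ b) → Acc _⟵_ t
  go zero    bound = acc λ p → contradiction (bound (next p done)) λ ()
  go (suc b) bound = acc λ p → go b (λ st → ≤-pred (bound (next p st)))

Acc⇒SN : ∀ {t} → Acc _⟵_ t → SN t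
Acc⇒SN (acc rs) = SN-intro λ p → Acc⇒SN (rs p)

Acc-appˡ : ∀ {t s} → Acc _⟵_ (t · s) → Acc _⟵_ t
Acc-appˡ (acc rs) = acc λ p → Acc-appˡ (rs (ξ-appL p))

Acc-appʳ : ∀ {t s} → Acc _⟵_ (t · s) → Acc _⟵_ s
Acc-appʳ (acc rs) = acc λ p → Acc-appʳ (rs (ξ-appR p))

data IsThrow : Tm → Set where
  isThrow : ∀ {α u} → IsThrow (throw α u)

IsThrow-⟶ : ∀ {t t'} → IsThrow t → t ⟶ t' → IsThrow t'
IsThrow-⟶ isThrow (ξ-throw _) = isThrow
IsThrow-⟶ isThrow thr-thr     = isThrow

IsThrow-↠ : ∀ {t t'} → IsThrow t → t ↠ t' → IsThrow t'
IsThrow-↠ h ε        = h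
IsThrow-↠ h (p ◅ ps) = IsThrow-↠ (IsThrow-⟶ h p) ps

Neutral : Tm → Set
Neutral t = ¬ Value t × ¬ IsThrow t

neutral-app : ∀ {t s} → ¬ Value t → Neutral (t · s)
neutral-app ¬v = (λ { (v-cons1 _) → ¬v v-cons0 ; (v-cons2 a _) → ¬v (v-cons1 a)
                    ; (v-lrec1 _) → ¬v v-lrec0 ; (v-lrec2 a _) → ¬v (v-lrec1 a) }) , λ ()

L-elim : ∀ {S t} → L S t → ∀ v w → Value v → Value w → t ↠ v ∷ₜ w → S v × L S w
L-elim (L-intro l) = l

L-↠ : ∀ {S t t'} → L S t → t ↠ t' → L S t'
L-↠ l ps = L-intro λ v w a b qs → L-elim l v w a b (ps ◅◅ qs)

⟦⟧-step : ∀ τ {t t'} → ⟦ τ ⟧ t → t ⟶ t' → ⟦ τ ⟧ t'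
⟦⟧-step unit     sn       p = SN-step sn p
⟦⟧-step (list σ) (sn , l) p = SN-step sn p , L-↠ l (p ◅ ε)
⟦⟧-step (σ ⇒ τ)  h        p = λ s hs → ⟦⟧-step τ (h s hs) (ξ-appL p)

⟦⟧⇒Acc : ∀ τ {t} → ⟦ τ ⟧ t → Acc _⟵_ t
⟦⟧-neutral : ∀ τ {t} → Neutral t → (∀ {t'} → t ⟶ t' → ⟦ τ ⟧ t') → ⟦ τ ⟧ t
⟦⟧-neutral-app : ∀ σ τ {t s} → Neutral t → (∀ {t'} → t ⟶ t' → ⟦ σ ⇒ τ ⟧ t') →
                 Acc _⟵_ s → ⟦ σ ⟧ s → ⟦ τ ⟧ (t · s)
⟦⟧-throw : ∀ τ {t} → IsThrow t → Acc _⟵_ t → ⟦ τ ⟧ t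
⟦⟧-throw-app : ∀ σ τ {t s} → IsThrow t → Acc _⟵_ t → Acc _⟵_ s → ⟦ σ ⟧ s → ⟦ τ ⟧ (t · s)

⟦⟧⇒Acc unit     sn       = SN⇒Acc sn
⟦⟧⇒Acc (list σ) (sn , _) = SN⇒Acc sn
-- Variables are values, hence not neutral: throw 0 ⋆ serves as the generic argument.
⟦⟧⇒Acc (σ ⇒ τ)  h        =
  Acc-appˡ (⟦⟧⇒Acc τ (h (throw 0 ⋆) (⟦⟧-throw σ isThrow (acc λ { (ξ-throw ()) }))))

⟦⟧-neutral unit     n h = SN-intro h
⟦⟧-neutral (list σ) n h = SN-intro (proj₁ ∘ h) , L-intro λ where
  v w a b ε        → contradiction (v-cons2 a b) (proj₁ n)
  v w a b (p ◅ ps) → L-elim (proj₂ (h p)) v w a b ps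
⟦⟧-neutral (σ ⇒ τ)  n h = λ s hs → ⟦⟧-neutral-app σ τ n h (⟦⟧⇒Acc σ hs) hs

⟦⟧-neutral-app σ τ n h (acc rs) hs = ⟦⟧-neutral τ (neutral-app (proj₁ n)) λ where
  (ξ-appL p)          → h p _ hs
  (ξ-appR p)          → ⟦⟧-neutral-app σ τ n h (rs p) (⟦⟧-step σ hs p)
  (β v)               → contradiction v-lam (proj₁ n)
  thr-appL            → contradiction isThrow (proj₂ n)
  (thr-appR v)        → contradiction v (proj₁ n)
  (lrec-nil a b)      → contradiction (v-lrec2 a b) (proj₁ n)
  (lrec-cons a b _ _) → contradiction (v-lrec2 a b) (proj₁ n)

⟦⟧-throw unit     _ acc-t = Acc⇒SN acc-t
⟦⟧-throw (list σ) h acc-t = Acc⇒SN acc-t , L-intro λ v w a b ps → case IsThrow-↠ h ps of λ ()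
⟦⟧-throw (σ ⇒ τ)  h acc-t = λ s hs → ⟦⟧-throw-app σ τ h acc-t (⟦⟧⇒Acc σ hs) hs

⟦⟧-throw-app σ τ isThrow acc-t@(acc rt) acc-s@(acc rs) hs = ⟦⟧-neutral τ ((λ ()) , (λ ())) λ where
  (ξ-appL p)   → ⟦⟧-throw-app σ τ (IsThrow-⟶ isThrow p) (rt p) acc-s hs
  (ξ-appR p)   → ⟦⟧-throw-app σ τ isThrow acc-t (rs p) (⟦⟧-step σ hs p)
  thr-appL     → ⟦⟧-throw τ isThrow acc-t
  (thr-appR ())

module _ (σ ρ : Ty) where

  StepType : Ty
  StepType = σ ⇒ list σ ⇒ ρ ⇒ ρ

  -- The L-derivation for t₀ is the primary induction measure; t₀ ↠ t lets t reduce while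
  -- that derivation stays fixed.
  lrec-⟦⟧ : ∀ {t₀ t r s} → L ⟦ σ ⟧ t₀ → t₀ ↠ t → Acc _⟵_ t →
            Acc _⟵_ r → ⟦ ρ ⟧ r → Acc _⟵_ s → ⟦ StepType ⟧ s → ⟦ ρ ⟧ (lrec · r · s · t)
  lrec-⟦⟧-⟶ : ∀ {t₀ t r s} → L ⟦ σ ⟧ t₀ → t₀ ↠ t → Acc _⟵_ t →
              Acc _⟵_ r → ⟦ ρ ⟧ r → Acc _⟵_ s → ⟦ StepType ⟧ s →
              ∀ {u} → lrec · r · s · t ⟶ u → ⟦ ρ ⟧ u

  lrec-⟦⟧ l ps acc-t acc-r hr acc-s hs =
    ⟦⟧-neutral ρ ((λ ()) , (λ ())) (lrec-⟦⟧-⟶ l ps acc-t acc-r hr acc-s hs)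

  lrec-⟦⟧-⟶ l ps acc-t (acc rr) hr acc-s hs (ξ-appL (ξ-appL (ξ-appR p))) =
    lrec-⟦⟧ l ps acc-t (rr p) (⟦⟧-step ρ hr p) acc-s hs
  lrec-⟦⟧-⟶ l ps acc-t acc-r hr (acc rs) hs (ξ-appL (ξ-appR p)) =
    lrec-⟦⟧ l ps acc-t acc-r hr (rs p) (⟦⟧-step StepType hs p)
  lrec-⟦⟧-⟶ l ps (acc rt) acc-r hr acc-s hs (ξ-appR p) =
    lrec-⟦⟧ l (ps ◅◅ p ◅ ε) (rt p) acc-r hr acc-s hs
  lrec-⟦⟧-⟶ {t = t} {s = s} l ps acc-t acc-r hr acc-s hs (ξ-appL (ξ-appL (thr-appR _))) =
    ⟦⟧-throw (StepType ⇒ list σ ⇒ ρ) isThrow acc-r s hs t (Acc⇒SN acc-t , L-↠ l ps)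
  lrec-⟦⟧-⟶ {t = t} l ps acc-t acc-r hr acc-s hs (ξ-appL (thr-appR _)) =
    ⟦⟧-throw (list σ ⇒ ρ) isThrow acc-s t (Acc⇒SN acc-t , L-↠ l ps)
  lrec-⟦⟧-⟶ l ps acc-t acc-r hr acc-s hs (thr-appR _)   = ⟦⟧-throw ρ isThrow acc-t
  lrec-⟦⟧-⟶ l ps acc-t acc-r hr acc-s hs (lrec-nil _ _) = hr
  lrec-⟦⟧-⟶ (L-intro elems) ps acc-t acc-r hr acc-s hs (lrec-cons {vh = v} {vt = w} _ _ a b) =
    hs v (proj₁ (elems v w a b ps)) w (Acc⇒SN (Acc-appʳ acc-t) , proj₂ (elems v w a b ps)) _
       (lrec-⟦⟧ (proj₂ (elems v w a b ps)) ε (Acc-appʳ acc-t) acc-r hr acc-s hs)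

lemma4p16 : (σ ρ : Ty) (r s t : Tm) →
    ⟦ ρ ⟧ r → ⟦ σ ⇒ list σ ⇒ ρ ⇒ ρ ⟧ s → ⟦ list σ ⟧ t →
    ⟦ ρ ⟧ (lrec · r · s · t)
lemma4p16 σ ρ r s t hr hs (sn-t , l-t) =
  lrec-⟦⟧ σ ρ l-t ε (SN⇒Acc sn-t) (⟦⟧⇒Acc ρ hr) hr (⟦⟧⇒Acc (StepType σ ρ) hs) hs
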